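{- In the DSC$(2)$ process, let $D^{(1)}(k,n)$ be the number of edges of $\mathcal{K}(n)$ contained in exactly $k$ triangles, and $N_0(n),N_1(n)$ the numbers of vertices and edges of $\mathcal{K}(n)$. Then for $n\ge2$, $$D^{(1)}(0,n)=N_0(n-1),\qquad D^{(1)}(1,n)=\tfrac35N_1(n),\qquad D^{(1)}(k,n)=D^{(1)}(k-1,n-1)\ (k\ge2),$$ and hence $D^{(1)}(k,n)=\tfrac35N_1(n-k+1)$ for $1\le k\le n-1$. With $N_1(n)=\frac1{\sqrt5}\big(g_+^n-g_-^n\big)$, $g_\pm=(5\pm\sqrt5)/2$, this gives $D^{(1)}(k,n)\simeq\frac{3(\sqrt5+1)}{10}\,g_+^{\,n-k}$ for large $n-k$.
   Context: The DSC$(2)$ process: $\mathcal{K}(0)$ consists of a single vertex. For $n\ge1$, $\mathcal{K}(n)$ is obtained from $\mathcal{K}(n-1)$ by adding, for every vertex and every edge $\sigma$ of $\mathcal{K}(n-1)$, a new vertex $w_\sigma$ together with the simplex $\sigma\cup\{w_\sigma\}$ and all its faces (distinct simplices receive distinct new vertices); triangles receive nothing. -}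

module Defs where

open import Data.Nat using (ℕ; zero; suc; _+_; _≡ᵇ_)
open import Data.Bool using (Bool; true; false; _∨_; _∧_; if_then_else_)
open import Data.List using (List; []; _∷_; _++_; length; map; upTo)
open import Data.Product using (_×_; _,_)

-- A finite simplicial complex of dimension ≤ 2, with vertices labelled
-- 0 , 1 , … , nV - 1.  Edges are unordered pairs {a , b} (stored as a pair
-- with a ≠ b), triangles are 3-element sets {x , y , z} (stored as triples).
-- Each simplex occurs exactly once in the respective list (by construction).
Edge : Set
Edge = ℕ × ℕ

Tri : Set
Tri = ℕ × ℕ × ℕ

record Complex : Set where
  constructor complex
  field
    nV    : ℕ
    edges : List Edge
    tris  : List Tri
open Complex public

coneEdges : ℕ → List Edge → List Edge
coneEdges w []             = []
coneEdges w ((a , b) ∷ es) = (a , w) ∷ (b , w) ∷ coneEdges (suc w) es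

coneTris : ℕ → List Edge → List Tri
coneTris w []             = []
coneTris w ((a , b) ∷ es) = (a , b , w) ∷ coneTris (suc w) es

-- One step of DSC(2): every vertex v gets a fresh vertex v' (label nV + v)
-- and the edge {v , v'}; every edge σ = {a , b} gets a fresh vertex w_σ
-- (labels nV + nV , nV + nV + 1 , …) together with the triangle
-- {a , b , w_σ} and its faces {a , w_σ}, {b , w_σ}.
step : Complex → Complex
step (complex n es ts) =
  complex (n + n + length es)
          (es ++ map (λ v → (v , n + v)) (upTo n) ++ coneEdges (n + n) es)
          (ts ++ coneTris (n + n) es)

K : ℕ → Complex
K zero    = complex 1 [] []
K (suc n) = step (K n)

N0 : ℕ → ℕ
N0 n = nV (K n)

N1 : ℕ → ℕ
N1 n = length (edges (K n))

countB : {A : Set} → (A → Bool) → List A → ℕ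
countB p []       = 0
countB p (x ∷ xs) = if p x then suc (countB p xs) else countB p xs

vInTri : ℕ → Tri → Bool
vInTri v (x , y , z) = (v ≡ᵇ x) ∨ (v ≡ᵇ y) ∨ (v ≡ᵇ z)

edgeInTri : Edge → Tri → Bool
edgeInTri (a , b) t = vInTri a t ∧ vInTri b t

triDeg : Complex → Edge → ℕ
triDeg c e = countB (edgeInTri e) (tris c)

D1 : ℕ → ℕ → ℕ
D1 k n = countB (λ e → triDeg (K n) e ≡ᵇ k) (edges (K n))

-- Each step puts exactly one new triangle on every existing edge, none on the pendant edges
-- {v , v'}, and the cone edges {a , w_σ}, {b , w_σ} of σ = {a , b} lie only in σ ∪ {w_σ}.
-- Hence D(0, n+1) = N₀(n), D(1, n+1) = D(0, n) + 2 N₁(n) and D(k+1, n+1) = D(k, n) for k ≥ 1.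
-- The first of these facts needs that no two listed edges span the same vertex pair; this is
-- kept as an invariant, together with the label ranges [0, N), [N, 2N), [2N, N′) of old,
-- pendant and cone vertices, which reduce every freshness claim to an inequality.
-- With N₀(n+1) = 2 N₀(n) + N₁(n) and N₁(n+1) = 3 N₁(n) + N₀(n), 5 D(1, n) = 3 N₁(n) is a
-- linear identity, and the shift carries it to every k.
module Submission where

open import Defs
open import Data.Nat using (ℕ; zero; suc; _+_; _*_; _∸_; _≤_; _<_; _≡ᵇ_; z≤n; s≤s; z<s)
open import Data.Nat.Properties
open import Data.Bool using (Bool; true; false; _∨_; _∧_)
open import Data.Bool.Properties using (∧-zeroʳ; ∨-zeroʳ; ∨-identityʳ)
open import Data.List using (List; []; _∷_; _++_; length; map; upTo; [_])
open import Data.List.Properties using (length-++; length-map; length-upTo; upTo-∷ʳ)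
open import Data.List.Relation.Unary.All as All using (All; []; _∷_)
open import Data.List.Relation.Unary.All.Properties using (++⁺; map⁺; all-upTo)
open import Data.Product using (_×_; _,_)
open import Data.Sum using (_⊎_; inj₁; inj₂)
open import Relation.Binary.PropositionalEquality hiding ([_])
open import Relation.Nullary using (yes; no)
open import Relation.Nullary.Decidable using (dec-true; dec-false)
open import Data.Nat.Tactic.RingSolver using (solve-∀)

vInEdge : ℕ → Edge → Bool
vInEdge v (a , b) = (v ≡ᵇ a) ∨ (v ≡ᵇ b)

edgeInEdge : Edge → Edge → Bool
edgeInEdge (a , b) e = vInEdge a e ∧ vInEdge b e

≡ᵇ-refl : ∀ m → (m ≡ᵇ m) ≡ true
≡ᵇ-refl m = dec-true (m ≟ m) refl

≢⇒≡ᵇ-false : ∀ {m n} → m ≢ n → (m ≡ᵇ n) ≡ false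
≢⇒≡ᵇ-false {m} {n} = dec-false (m ≟ n)

vInEdge-fst : ∀ v b → vInEdge v (v , b) ≡ true
vInEdge-fst v b = cong (_∨ (v ≡ᵇ b)) (≡ᵇ-refl v)

vInEdge-snd : ∀ a v → vInEdge v (a , v) ≡ true
vInEdge-snd a v = trans (cong ((v ≡ᵇ a) ∨_) (≡ᵇ-refl v)) (∨-zeroʳ (v ≡ᵇ a))

vInTri-fst : ∀ v y z → vInTri v (v , y , z) ≡ true
vInTri-fst v y z = cong (_∨ vInEdge v (y , z)) (≡ᵇ-refl v)

vInTri-snd : ∀ x v z → vInTri v (x , v , z) ≡ true
vInTri-snd x v z = trans (cong ((v ≡ᵇ x) ∨_) (vInEdge-fst v z)) (∨-zeroʳ (v ≡ᵇ x))

vInTri-thd : ∀ x y v → vInTri v (x , y , v) ≡ true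
vInTri-thd x y v = trans (cong ((v ≡ᵇ x) ∨_) (vInEdge-snd y v)) (∨-zeroʳ (v ≡ᵇ x))

edgeInEdge-refl : ∀ a b → edgeInEdge (a , b) (a , b) ≡ true
edgeInEdge-refl a b = trans (cong (_∧ vInEdge b (a , b)) (vInEdge-fst a b)) (vInEdge-snd a b)

vInEdge-absent : ∀ {v a b} → v ≢ a → v ≢ b → vInEdge v (a , b) ≡ false
vInEdge-absent v≢a v≢b = cong₂ _∨_ (≢⇒≡ᵇ-false v≢a) (≢⇒≡ᵇ-false v≢b)

vInTri-absent : ∀ {v x y z} → v ≢ x → v ≢ y → v ≢ z → vInTri v (x , y , z) ≡ false
vInTri-absent v≢x v≢y v≢z = cong₂ _∨_ (≢⇒≡ᵇ-false v≢x) (vInEdge-absent v≢y v≢z)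

vInTri-≢-thd : ∀ {v z} x y → v ≢ z → vInTri v (x , y , z) ≡ vInEdge v (x , y)
vInTri-≢-thd {v} x y v≢z =
  cong ((v ≡ᵇ x) ∨_) (trans (cong ((v ≡ᵇ y) ∨_) (≢⇒≡ᵇ-false v≢z)) (∨-identityʳ (v ≡ᵇ y)))

edgeInTri-absent : ∀ a b t → vInTri b t ≡ false → edgeInTri (a , b) t ≡ false
edgeInTri-absent a b t b∉t = trans (cong (vInTri a t ∧_) b∉t) (∧-zeroʳ (vInTri a t))

edgeInEdge-absentˡ : ∀ a b e → vInEdge a e ≡ false → edgeInEdge (a , b) e ≡ false
edgeInEdge-absentˡ a b e a∉e = cong (_∧ vInEdge b e) a∉e

edgeInEdge-absentʳ : ∀ a b e → vInEdge b e ≡ false → edgeInEdge (a , b) e ≡ false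
edgeInEdge-absentʳ a b e b∉e = trans (cong (vInEdge a e ∧_) b∉e) (∧-zeroʳ (vInEdge a e))

-- two distinct vertices cannot both equal the first endpoint
edgeInEdge-≢-snd : ∀ {a b} x {y} → a ≢ b → a ≢ y → b ≢ y → edgeInEdge (a , b) (x , y) ≡ false
edgeInEdge-≢-snd {a} {b} x a≢b a≢y b≢y with a ≟ x
... | yes refl = edgeInEdge-absentʳ a b (x , _) (vInEdge-absent (≢-sym a≢b) b≢y)
... | no a≢x   = edgeInEdge-absentˡ a b (x , _) (vInEdge-absent a≢x a≢y)

module _ {A : Set} where

  countB-++ : ∀ p (xs ys : List A) → countB p (xs ++ ys) ≡ countB p xs + countB p ys
  countB-++ p []       ys = refl
  countB-++ p (x ∷ xs) ys with p x
  ... | true  = cong suc (countB-++ p xs ys)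
  ... | false = countB-++ p xs ys

  countB-∷-true : ∀ {p x} (xs : List A) → p x ≡ true → countB p (x ∷ xs) ≡ suc (countB p xs)
  countB-∷-true xs px rewrite px = refl

  countB-∷-false : ∀ {p x} (xs : List A) → p x ≡ false → countB p (x ∷ xs) ≡ countB p xs
  countB-∷-false xs px rewrite px = refl

  countB-none : ∀ {p} {xs : List A} → All (λ x → p x ≡ false) xs → countB p xs ≡ 0
  countB-none []                = refl
  countB-none {xs = _ ∷ xs} (px ∷ pxs) = trans (countB-∷-false xs px) (countB-none pxs)

  countB-every : ∀ {p} {xs : List A} → All (λ x → p x ≡ true) xs → countB p xs ≡ length xs
  countB-every []                = refl
  countB-every {xs = _ ∷ xs} (px ∷ pxs) = trans (countB-∷-true xs px) (cong suc (countB-every pxs))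

  countB-false : (xs : List A) → countB (λ _ → false) xs ≡ 0
  countB-false xs = countB-none (All.universal (λ _ → refl) xs)

  countB-true : (xs : List A) → countB (λ _ → true) xs ≡ length xs
  countB-true xs = countB-every (All.universal (λ _ → refl) xs)

  countB-cong : ∀ {p q} {xs : List A} → All (λ x → p x ≡ q x) xs → countB p xs ≡ countB q xs
  countB-cong []                      = refl
  countB-cong {p} {q} {x ∷ _} (px≡qx ∷ eqs) rewrite px≡qx | countB-cong eqs = refl

  countB-≡ᵇ-cong : ∀ {f g : A → ℕ} {xs : List A} k → All (λ x → f x ≡ g x) xs →
                   countB (λ x → f x ≡ᵇ k) xs ≡ countB (λ x → g x ≡ᵇ k) xs
  countB-≡ᵇ-cong k eqs = countB-cong (All.map (cong (_≡ᵇ k)) eqs)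

countB-map : ∀ {A B : Set} (p : B → Bool) (f : A → B) (xs : List A) →
             countB p (map f xs) ≡ countB (λ x → p (f x)) xs
countB-map p f []       = refl
countB-map p f (x ∷ xs) with p (f x)
... | true  = cong suc (countB-map p f xs)
... | false = countB-map p f xs

countB-∷-cong : ∀ {A B : Set} {p : A → Bool} {q : B → Bool} {x y} xs ys →
                p x ≡ q y → countB p xs ≡ countB q ys → countB p (x ∷ xs) ≡ countB q (y ∷ ys)
countB-∷-cong xs ys px≡qy eq rewrite px≡qy | eq = refl

countB-≡ᵇ-upTo : ∀ {v} n → v < n → countB (_≡ᵇ v) (upTo n) ≡ 1
countB-≡ᵇ-upTo {v} (suc n) (s≤s v≤n) = begin
  countB (_≡ᵇ v) (upTo (suc n))                     ≡⟨ cong (countB (_≡ᵇ v)) (upTo-∷ʳ n) ⟨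
  countB (_≡ᵇ v) (upTo n ++ [ n ])                  ≡⟨ countB-++ (_≡ᵇ v) (upTo n) [ n ] ⟩
  countB (_≡ᵇ v) (upTo n) + countB (_≡ᵇ v) [ n ]    ≡⟨ split (m≤n⇒m<n∨m≡n v≤n) ⟩
  1                                                 ∎
  where
  open ≡-Reasoning
  split : v < n ⊎ v ≡ n → countB (_≡ᵇ v) (upTo n) + countB (_≡ᵇ v) [ n ] ≡ 1
  split (inj₁ v<n)  = cong₂ _+_ (countB-≡ᵇ-upTo n v<n)
                                (countB-none {p = _≡ᵇ v} {[ n ]} (≢⇒≡ᵇ-false (>⇒≢ v<n) ∷ []))
  split (inj₂ refl) = cong₂ _+_ (countB-none {p = _≡ᵇ v} (All.map (λ u<v → ≢⇒≡ᵇ-false (<⇒≢ u<v)) (all-upTo v)))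
                                (countB-every {p = _≡ᵇ v} {[ v ]} (≡ᵇ-refl v ∷ []))

countB-edgeInTri-absent : ∀ a b {ts} → All (λ t → vInTri b t ≡ false) ts →
                          countB (edgeInTri (a , b)) ts ≡ 0
countB-edgeInTri-absent a b b∉ts = countB-none (All.map (edgeInTri-absent a b _) b∉ts)

countB-edgeInEdge-absent : ∀ a b {es} → All (λ e → vInEdge b e ≡ false) es →
                           countB (edgeInEdge (a , b)) es ≡ 0
countB-edgeInEdge-absent a b b∉es = countB-none (All.map (edgeInEdge-absentʳ a b _) b∉es)

ProperEdge : ℕ → Edge → Set
ProperEdge N (a , b) = a < N × b < N × a ≢ b

TriBelow : ℕ → Tri → Set
TriBelow N (x , y , z) = x < N × y < N × z < N

ConeEdge : ℕ → ℕ → ℕ → Edge → Set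
ConeEdge N w u (x , y) = x < N × w ≤ y × y < u

ConeTri : ℕ → ℕ → ℕ → Tri → Set
ConeTri N w u (x , y , z) = x < N × y < N × w ≤ z × z < u

PendantEdge : ℕ → Edge → Set
PendantEdge N (x , y) = x < N × y ≡ N + x

vInEdge-≥ : ∀ {N v e} → ProperEdge N e → N ≤ v → vInEdge v e ≡ false
vInEdge-≥ (a<N , b<N , _) N≤v = vInEdge-absent (>⇒≢ (<-≤-trans a<N N≤v)) (>⇒≢ (<-≤-trans b<N N≤v))

vInTri-≥ : ∀ {N v t} → TriBelow N t → N ≤ v → vInTri v t ≡ false
vInTri-≥ (x<N , y<N , z<N) N≤v =
  vInTri-absent (>⇒≢ (<-≤-trans x<N N≤v)) (>⇒≢ (<-≤-trans y<N N≤v)) (>⇒≢ (<-≤-trans z<N N≤v))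

vInEdge-coneGap : ∀ {N w u v e} → ConeEdge N w u e → N ≤ v → v < w → vInEdge v e ≡ false
vInEdge-coneGap (x<N , w≤y , _) N≤v v<w = vInEdge-absent (>⇒≢ (<-≤-trans x<N N≤v)) (<⇒≢ (<-≤-trans v<w w≤y))

vInTri-coneGap : ∀ {N w u v t} → ConeTri N w u t → N ≤ v → v < w → vInTri v t ≡ false
vInTri-coneGap (x<N , y<N , w≤z , _) N≤v v<w =
  vInTri-absent (>⇒≢ (<-≤-trans x<N N≤v)) (>⇒≢ (<-≤-trans y<N N≤v)) (<⇒≢ (<-≤-trans v<w w≤z))

vInEdge-pendant-≥ : ∀ {N v e} → PendantEdge N e → N + N ≤ v → vInEdge v e ≡ false
vInEdge-pendant-≥ {N} {v} {x , _} (x<N , refl) N+N≤v =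
  vInEdge-absent (>⇒≢ (<-≤-trans x<N (≤-trans (m≤m+n N N) N+N≤v))) (>⇒≢ (<-≤-trans (+-monoʳ-< N x<N) N+N≤v))

length-coneEdges : ∀ w es → length (coneEdges w es) ≡ length es + length es
length-coneEdges w []       = refl
length-coneEdges w (e ∷ es) =
  cong suc (trans (cong suc (length-coneEdges (suc w) es)) (sym (+-suc (length es) (length es))))

coneEdges-shape : ∀ {N u} w es → All (ProperEdge N) es → w + length es ≤ u →
                  All (ConeEdge N w u) (coneEdges w es)
coneEdges-shape w []             []                          _     = []
coneEdges-shape {N} {u} w (_ ∷ es) ((a<N , b<N , _) ∷ proper) bound =
  (a<N , ≤-refl , w<u) ∷ (b<N , ≤-refl , w<u) ∷ All.map lower (coneEdges-shape (suc w) es proper bound′)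
  where
  w<u : w < u
  w<u = <-≤-trans (m<m+n w z<s) bound
  bound′ : suc w + length es ≤ u
  bound′ = subst (_≤ u) (+-suc w (length es)) bound
  lower : ∀ {e} → ConeEdge N (suc w) u e → ConeEdge N w u e
  lower (x<N , w<y , y<u) = x<N , <⇒≤ w<y , y<u

coneTris-shape : ∀ {N u} w es → All (ProperEdge N) es → w + length es ≤ u →
                 All (ConeTri N w u) (coneTris w es)
coneTris-shape w []             []                          _     = []
coneTris-shape {N} {u} w (_ ∷ es) ((a<N , b<N , _) ∷ proper) bound =
  (a<N , b<N , ≤-refl , <-≤-trans (m<m+n w z<s) bound)
  ∷ All.map lower (coneTris-shape (suc w) es proper (subst (_≤ u) (+-suc w (length es)) bound))
  where
  lower : ∀ {t} → ConeTri N (suc w) u t → ConeTri N w u t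
  lower (x<N , y<N , w<z , z<u) = x<N , y<N , <⇒≤ w<z , z<u

countB-edgeInTri-coneTris : ∀ {a b} w es → a < w → b < w →
                            countB (edgeInTri (a , b)) (coneTris w es) ≡ countB (edgeInEdge (a , b)) es
countB-edgeInTri-coneTris w []             _   _   = refl
countB-edgeInTri-coneTris {a} {b} w ((x , y) ∷ es) a<w b<w =
  countB-∷-cong (coneTris (suc w) es) es
                (cong₂ _∧_ (vInTri-≢-thd x y (<⇒≢ a<w)) (vInTri-≢-thd x y (<⇒≢ b<w)))
                (countB-edgeInTri-coneTris (suc w) es (m<n⇒m<1+n a<w) (m<n⇒m<1+n b<w))

coneEdges-inOneConeTri : ∀ {N} w es → All (ProperEdge N) es → N ≤ w →
                         All (λ e → countB (edgeInTri e) (coneTris w es) ≡ 1) (coneEdges w es)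
coneEdges-inOneConeTri w []             []                            _   = []
coneEdges-inOneConeTri {N} w ((a , b) ∷ es) ((a<N , b<N , _) ∷ proper) N≤w =
  inHead a (vInTri-fst a b w) ∷ inHead b (vInTri-snd a b w)
  ∷ All.zipWith later (coneEdges-shape (suc w) es proper ≤-refl ,
                       coneEdges-inOneConeTri (suc w) es proper (m≤n⇒m≤1+n N≤w))
  where
  a<w : a < w
  a<w = <-≤-trans a<N N≤w
  b<w : b < w
  b<w = <-≤-trans b<N N≤w
  rest : List Tri
  rest = coneTris (suc w) es
  inHead : ∀ x → vInTri x (a , b , w) ≡ true → countB (edgeInTri (x , w)) ((a , b , w) ∷ rest) ≡ 1
  inHead x x∈t = trans (countB-∷-true rest (cong₂ _∧_ x∈t (vInTri-thd a b w)))
                       (cong suc (countB-edgeInTri-absent x w (All.map (λ ct → vInTri-coneGap ct N≤w (n<1+n w))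
                                                                  (coneTris-shape (suc w) es proper ≤-refl))))
  later : ∀ {e u} → ConeEdge N (suc w) u e × countB (edgeInTri e) rest ≡ 1 →
          countB (edgeInTri e) ((a , b , w) ∷ rest) ≡ 1
  later {x , y} ((_ , w<y , _) , inOne) =
    trans (countB-∷-false rest (edgeInTri-absent x y (a , b , w)
            (vInTri-absent (>⇒≢ (<-trans a<w w<y)) (>⇒≢ (<-trans b<w w<y)) (>⇒≢ w<y))))
          inOne

coneEdges-unique : ∀ {N} w es → All (ProperEdge N) es → N ≤ w →
                   All (λ e → countB (edgeInEdge e) (coneEdges w es) ≡ 1) (coneEdges w es)
coneEdges-unique w []             []                             _   = []
coneEdges-unique {N} w ((a , b) ∷ es) ((a<N , b<N , a≢b) ∷ proper) N≤w =
  trans (countB-∷-true ((b , w) ∷ rest) (edgeInEdge-refl a w))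
        (cong suc (trans (countB-∷-false rest (∉other a≢b a<w)) (w∉rest a)))
  ∷ trans (countB-∷-false ((b , w) ∷ rest) (∉other (≢-sym a≢b) b<w))
          (trans (countB-∷-true rest (edgeInEdge-refl b w)) (cong suc (w∉rest b)))
  ∷ All.zipWith later (coneEdges-shape (suc w) es proper ≤-refl ,
                       coneEdges-unique (suc w) es proper (m≤n⇒m≤1+n N≤w))
  where
  a<w : a < w
  a<w = <-≤-trans a<N N≤w
  b<w : b < w
  b<w = <-≤-trans b<N N≤w
  rest : List Edge
  rest = coneEdges (suc w) es
  ∉other : ∀ {x z} → x ≢ z → x < w → edgeInEdge (x , w) (z , w) ≡ false
  ∉other {x} {z} x≢z x<w = edgeInEdge-absentˡ x w (z , w) (vInEdge-absent x≢z (<⇒≢ x<w))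
  w∉rest : ∀ x → countB (edgeInEdge (x , w)) rest ≡ 0
  w∉rest x = countB-edgeInEdge-absent x w (All.map (λ ce → vInEdge-coneGap ce N≤w (n<1+n w))
                                                    (coneEdges-shape (suc w) es proper ≤-refl))
  later : ∀ {e u} → ConeEdge N (suc w) u e × countB (edgeInEdge e) rest ≡ 1 →
          countB (edgeInEdge e) ((a , w) ∷ (b , w) ∷ rest) ≡ 1
  later {x , y} ((_ , w<y , _) , unique) =
    trans (countB-∷-false ((b , w) ∷ rest) (y∉ a<w))
          (trans (countB-∷-false rest (y∉ b<w)) unique)
    where
    y∉ : ∀ {z} → z < w → edgeInEdge (x , y) (z , w) ≡ false
    y∉ z<w = edgeInEdge-absentʳ x y (_ , w) (vInEdge-absent (>⇒≢ (<-trans z<w w<y)) (>⇒≢ w<y))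

record WellFormed (c : Complex) : Set where
  field
    edgesProper : All (ProperEdge (nV c)) (edges c)
    trisBelow   : All (TriBelow (nV c)) (tris c)
    edgesUnique : All (λ e → countB (edgeInEdge e) (edges c) ≡ 1) (edges c)

edgesOfTriDeg : Complex → ℕ → ℕ
edgesOfTriDeg c k = countB (λ e → triDeg c e ≡ᵇ k) (edges c)

module Step (c : Complex) (wf : WellFormed c) where
  open WellFormed wf

  N N′ L : ℕ
  N  = nV c
  N′ = nV (step c)
  L  = length (edges c)

  pendant : ℕ → Edge
  pendant v = v , N + v

  pendants cones : List Edge
  pendants = map pendant (upTo N)
  cones    = coneEdges (N + N) (edges c)

  coneTriangles : List Tri
  coneTriangles = coneTris (N + N) (edges c)

  N≤N+N : N ≤ N + N
  N≤N+N = m≤m+n N N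

  N+N≤N′ : N + N ≤ N′
  N+N≤N′ = m≤m+n (N + N) L

  pendants-shape : All (PendantEdge N) pendants
  pendants-shape = map⁺ (All.map (λ v<N → v<N , refl) (all-upTo N))

  cones-shape : All (ConeEdge N (N + N) N′) cones
  cones-shape = coneEdges-shape (N + N) (edges c) edgesProper ≤-refl

  coneTriangles-shape : All (ConeTri N (N + N) N′) coneTriangles
  coneTriangles-shape = coneTris-shape (N + N) (edges c) edgesProper ≤-refl

  triDeg-step : ∀ e → triDeg (step c) e ≡ triDeg c e + countB (edgeInTri e) coneTriangles
  triDeg-step e = countB-++ (edgeInTri e) (tris c) coneTriangles

  triDeg-≥ : ∀ x {y} → N ≤ y → triDeg c (x , y) ≡ 0
  triDeg-≥ x {y} N≤y = countB-edgeInTri-absent x y (All.map (λ below → vInTri-≥ below N≤y) trisBelow)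

  triDeg-step-old : All (λ e → triDeg (step c) e ≡ suc (triDeg c e)) (edges c)
  triDeg-step-old = All.zipWith old (edgesProper , edgesUnique)
    where
    old : ∀ {e} → ProperEdge N e × countB (edgeInEdge e) (edges c) ≡ 1 → triDeg (step c) e ≡ suc (triDeg c e)
    old {a , b} ((a<N , b<N , _) , unique) = begin
      triDeg (step c) (a , b)                                ≡⟨ triDeg-step (a , b) ⟩
      triDeg c (a , b) + countB (edgeInTri (a , b)) coneTriangles
        ≡⟨ cong (triDeg c (a , b) +_)
                (countB-edgeInTri-coneTris (N + N) (edges c) (<-≤-trans a<N N≤N+N) (<-≤-trans b<N N≤N+N)) ⟩
      triDeg c (a , b) + countB (edgeInEdge (a , b)) (edges c) ≡⟨ cong (triDeg c (a , b) +_) unique ⟩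
      triDeg c (a , b) + 1                                   ≡⟨ +-comm (triDeg c (a , b)) 1 ⟩
      suc (triDeg c (a , b))                                 ∎
      where open ≡-Reasoning

  triDeg-step-pendant : All (λ e → triDeg (step c) e ≡ 0) pendants
  triDeg-step-pendant = All.map pendantDeg pendants-shape
    where
    pendantDeg : ∀ {e} → PendantEdge N e → triDeg (step c) e ≡ 0
    pendantDeg {x , _} (x<N , refl) =
      trans (triDeg-step (x , N + x))
            (cong₂ _+_ (triDeg-≥ x (m≤m+n N x))
                       (countB-edgeInTri-absent x (N + x)
                          (All.map (λ ct → vInTri-coneGap ct (m≤m+n N x) (+-monoʳ-< N x<N)) coneTriangles-shape)))

  triDeg-step-cone : All (λ e → triDeg (step c) e ≡ 1) cones
  triDeg-step-cone =
    All.zipWith coneDeg (cones-shape , coneEdges-inOneConeTri (N + N) (edges c) edgesProper N≤N+N)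
    where
    coneDeg : ∀ {e} → ConeEdge N (N + N) N′ e × countB (edgeInTri e) coneTriangles ≡ 1 → triDeg (step c) e ≡ 1
    coneDeg {x , y} ((_ , N+N≤y , _) , inOne) =
      trans (triDeg-step (x , y)) (cong₂ _+_ (triDeg-≥ x (≤-trans N≤N+N N+N≤y)) inOne)

  edgesOfTriDeg-step : ∀ k → edgesOfTriDeg (step c) k ≡
    countB (λ e → suc (triDeg c e) ≡ᵇ k) (edges c) + (countB (λ _ → 0 ≡ᵇ k) pendants + countB (λ _ → 1 ≡ᵇ k) cones)
  edgesOfTriDeg-step k =
    trans (countB-++ p (edges c) (pendants ++ cones))
          (cong₂ _+_ (countB-≡ᵇ-cong k triDeg-step-old)
                     (trans (countB-++ p pendants cones)
                            (cong₂ _+_ (countB-≡ᵇ-cong k triDeg-step-pendant) (countB-≡ᵇ-cong k triDeg-step-cone))))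
    where
    p : Edge → Bool
    p e = triDeg (step c) e ≡ᵇ k

  length-pendants : length pendants ≡ N
  length-pendants = trans (length-map pendant (upTo N)) (length-upTo N)

  edgesOfTriDeg-step-zero : edgesOfTriDeg (step c) 0 ≡ N
  edgesOfTriDeg-step-zero =
    trans (edgesOfTriDeg-step 0)
          (cong₂ _+_ (countB-false (edges c))
                     (trans (cong₂ _+_ (trans (countB-true pendants) length-pendants) (countB-false cones))
                            (+-identityʳ N)))

  edgesOfTriDeg-step-one : edgesOfTriDeg (step c) 1 ≡ edgesOfTriDeg c 0 + (L + L)
  edgesOfTriDeg-step-one =
    trans (edgesOfTriDeg-step 1)
          (cong (edgesOfTriDeg c 0 +_) (cong₂ _+_ (countB-false pendants)
                                                  (trans (countB-true cones) (length-coneEdges (N + N) (edges c)))))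

  edgesOfTriDeg-step-suc-suc : ∀ k → edgesOfTriDeg (step c) (2 + k) ≡ edgesOfTriDeg c (suc k)
  edgesOfTriDeg-step-suc-suc k =
    trans (edgesOfTriDeg-step (2 + k))
          (trans (cong (edgesOfTriDeg c (suc k) +_) (cong₂ _+_ (countB-false pendants) (countB-false cones)))
                 (+-identityʳ (edgesOfTriDeg c (suc k))))

  length-edges-step : length (edges (step c)) ≡ L + (N + (L + L))
  length-edges-step =
    trans (length-++ (edges c))
          (cong (L +_) (trans (length-++ pendants) (cong₂ _+_ length-pendants (length-coneEdges (N + N) (edges c)))))

  N≤N′ : N ≤ N′
  N≤N′ = ≤-trans N≤N+N N+N≤N′

  proper-old : ∀ {e} → ProperEdge N e → ProperEdge N′ e
  proper-old (a<N , b<N , a≢b) = <-≤-trans a<N N≤N′ , <-≤-trans b<N N≤N′ , a≢b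

  proper-pendant : ∀ {e} → PendantEdge N e → ProperEdge N′ e
  proper-pendant {x , _} (x<N , refl) =
    <-≤-trans x<N N≤N′ , <-≤-trans (+-monoʳ-< N x<N) N+N≤N′ , <⇒≢ (<-≤-trans x<N (m≤m+n N x))

  proper-cone : ∀ {e} → ConeEdge N (N + N) N′ e → ProperEdge N′ e
  proper-cone (x<N , N+N≤y , y<N′) = <-≤-trans x<N N≤N′ , y<N′ , <⇒≢ (<-≤-trans x<N (≤-trans N≤N+N N+N≤y))

  below-old : ∀ {t} → TriBelow N t → TriBelow N′ t
  below-old (x<N , y<N , z<N) = <-≤-trans x<N N≤N′ , <-≤-trans y<N N≤N′ , <-≤-trans z<N N≤N′

  below-cone : ∀ {t} → ConeTri N (N + N) N′ t → TriBelow N′ t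
  below-cone (x<N , y<N , _ , z<N′) = <-≤-trans x<N N≤N′ , <-≤-trans y<N N≤N′ , z<N′

  countB-edges-step : ∀ p → countB p (edges (step c)) ≡ countB p (edges c) + (countB p pendants + countB p cones)
  countB-edges-step p = trans (countB-++ p (edges c) (pendants ++ cones))
                              (cong (countB p (edges c) +_) (countB-++ p pendants cones))

  unique-old : ∀ {e} → ProperEdge N e × countB (edgeInEdge e) (edges c) ≡ 1 → countB (edgeInEdge e) (edges (step c)) ≡ 1
  unique-old {a , b} ((a<N , b<N , a≢b) , unique) =
    trans (countB-edges-step (edgeInEdge (a , b)))
          (cong₂ _+_ unique (cong₂ _+_ (countB-none (All.map inPendant pendants-shape))
                                       (countB-none (All.map inCone cones-shape))))
    where
    notIn : ∀ x {y} → N ≤ y → edgeInEdge (a , b) (x , y) ≡ false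
    notIn x N≤y = edgeInEdge-≢-snd x a≢b (<⇒≢ (<-≤-trans a<N N≤y)) (<⇒≢ (<-≤-trans b<N N≤y))
    inPendant : ∀ {e} → PendantEdge N e → edgeInEdge (a , b) e ≡ false
    inPendant {x , _} (_ , refl) = notIn x (m≤m+n N x)
    inCone : ∀ {e} → ConeEdge N (N + N) N′ e → edgeInEdge (a , b) e ≡ false
    inCone {x , _} (_ , N+N≤y , _) = notIn x (≤-trans N≤N+N N+N≤y)

  unique-pendant : ∀ {e} → PendantEdge N e → countB (edgeInEdge e) (edges (step c)) ≡ 1
  unique-pendant {v , _} (v<N , refl) =
    trans (countB-edges-step (edgeInEdge (v , N + v)))
          (cong₂ _+_ (countB-edgeInEdge-absent v (N + v) (All.map (λ proper → vInEdge-≥ proper (m≤m+n N v)) edgesProper))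
                     (cong₂ _+_ inPendants
                                (countB-edgeInEdge-absent v (N + v)
                                   (All.map (λ ce → vInEdge-coneGap ce (m≤m+n N v) (+-monoʳ-< N v<N)) cones-shape))))
    where
    sameIndex : ∀ {u} → u < N → edgeInEdge (v , N + v) (pendant u) ≡ (u ≡ᵇ v)
    sameIndex {u} u<N with u ≟ v
    ... | yes refl = trans (edgeInEdge-refl v (N + v)) (sym (≡ᵇ-refl v))
    ... | no u≢v   = trans (edgeInEdge-absentˡ v (N + v) (pendant u)
                                (vInEdge-absent (≢-sym u≢v) (<⇒≢ (<-≤-trans v<N (m≤m+n N u)))))
                           (sym (≢⇒≡ᵇ-false u≢v))
    inPendants : countB (edgeInEdge (v , N + v)) pendants ≡ 1
    inPendants = trans (countB-map (edgeInEdge (v , N + v)) pendant (upTo N))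
                       (trans (countB-cong (All.map sameIndex (all-upTo N))) (countB-≡ᵇ-upTo N v<N))

  unique-cone : ∀ {e} → ConeEdge N (N + N) N′ e × countB (edgeInEdge e) cones ≡ 1 →
                countB (edgeInEdge e) (edges (step c)) ≡ 1
  unique-cone {x , y} ((_ , N+N≤y , _) , unique) =
    trans (countB-edges-step (edgeInEdge (x , y)))
          (cong₂ _+_ (countB-edgeInEdge-absent x y
                        (All.map (λ proper → vInEdge-≥ proper (≤-trans N≤N+N N+N≤y)) edgesProper))
                     (cong₂ _+_ (countB-edgeInEdge-absent x y (All.map (λ pe → vInEdge-pendant-≥ pe N+N≤y) pendants-shape))
                                unique))

  wellFormed-step : WellFormed (step c)
  wellFormed-step = record
    { edgesProper = ++⁺ (All.map proper-old edgesProper)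
                        (++⁺ (All.map proper-pendant pendants-shape) (All.map proper-cone cones-shape))
    ; trisBelow   = ++⁺ (All.map below-old trisBelow) (All.map below-cone coneTriangles-shape)
    ; edgesUnique = ++⁺ (All.zipWith unique-old (edgesProper , edgesUnique))
                        (++⁺ (All.map unique-pendant pendants-shape)
                             (All.zipWith unique-cone (cones-shape , coneEdges-unique (N + N) (edges c) edgesProper N≤N+N)))
    }

wellFormed-K : ∀ n → WellFormed (K n)
wellFormed-K zero    = record { edgesProper = [] ; trisBelow = [] ; edgesUnique = [] }
wellFormed-K (suc n) = Step.wellFormed-step (K n) (wellFormed-K n)

D1-zero-suc : ∀ n → D1 0 (suc n) ≡ N0 n
D1-zero-suc n = Step.edgesOfTriDeg-step-zero (K n) (wellFormed-K n)

D1-one-suc : ∀ n → D1 1 (suc n) ≡ D1 0 n + (N1 n + N1 n)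
D1-one-suc n = Step.edgesOfTriDeg-step-one (K n) (wellFormed-K n)

D1-suc-suc : ∀ k n → D1 (2 + k) (suc n) ≡ D1 (suc k) n
D1-suc-suc k n = Step.edgesOfTriDeg-step-suc-suc (K n) (wellFormed-K n) k

N1-suc : ∀ n → N1 (suc n) ≡ N1 n + (N0 n + (N1 n + N1 n))
N1-suc n = Step.length-edges-step (K n) (wellFormed-K n)

five-D1-one : ∀ n → 5 * D1 1 (2 + n) ≡ 3 * N1 (2 + n)
five-D1-one n = begin
  5 * D1 1 (2 + n)                                  ≡⟨ cong (5 *_) (D1-one-suc (suc n)) ⟩
  5 * (D1 0 (suc n) + (N1 (suc n) + N1 (suc n)))    ≡⟨ cong (λ d → 5 * (d + (N1 (suc n) + N1 (suc n)))) (D1-zero-suc n) ⟩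
  5 * (x + (N1 (suc n) + N1 (suc n)))               ≡⟨ cong (λ m → 5 * (x + (m + m))) (N1-suc n) ⟩
  5 * (x + (y′ + y′))                               ≡⟨ linear x y ⟩
  3 * (y′ + ((x + x + y) + (y′ + y′)))              ≡⟨ cong (λ m → 3 * (m + (N0 (suc n) + (m + m)))) (N1-suc n) ⟨
  3 * (N1 (suc n) + (N0 (suc n) + (N1 (suc n) + N1 (suc n))))  ≡⟨ cong (3 *_) (N1-suc (suc n)) ⟨
  3 * N1 (2 + n)                                    ∎
  where
  open ≡-Reasoning
  x y y′ : ℕ
  x  = N0 n
  y  = N1 n
  y′ = y + (x + (y + y))
  linear : ∀ x y → 5 * (x + ((y + (x + (y + y))) + (y + (x + (y + y)))))
                 ≡ 3 * ((y + (x + (y + y))) + ((x + x + y) + ((y + (x + (y + y))) + (y + (x + (y + y))))))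
  linear = solve-∀

five-D1≡three-N1 : ∀ k n → suc k ≤ n ∸ 1 → 5 * D1 (suc k) n ≡ 3 * N1 ((n ∸ suc k) + 1)
five-D1≡three-N1 zero    (suc (suc n)) _         =
  trans (five-D1-one n) (cong (λ m → 3 * N1 m) (+-comm 1 (suc n)))
five-D1≡three-N1 (suc k) (suc (suc n)) (s≤s k<n) =
  trans (cong (5 *_) (D1-suc-suc k (suc n))) (five-D1≡three-N1 k (suc n) k<n)

mainTheorem12 : (n : ℕ) → 2 ≤ n →
      (D1 0 n ≡ N0 (n ∸ 1))
    × (5 * D1 1 n ≡ 3 * N1 n)
    × ((k : ℕ) → 2 ≤ k → D1 k n ≡ D1 (k ∸ 1) (n ∸ 1))
    × ((k : ℕ) → 1 ≤ k → k ≤ n ∸ 1 → 5 * D1 k n ≡ 3 * N1 ((n ∸ k) + 1))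
mainTheorem12 (suc (suc n)) (s≤s (s≤s z≤n)) =
  D1-zero-suc (suc n) , five-D1-one n , shift , λ { (suc k) _ → five-D1≡three-N1 k (2 + n) }
  where
  shift : (k : ℕ) → 2 ≤ k → D1 k (2 + n) ≡ D1 (k ∸ 1) (suc n)
  shift (suc (suc k)) (s≤s (s≤s z≤n)) = D1-suc-suc k (suc n)
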